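{- There is a family $D$ of interval partitions such that: (1) $|D|\le\mathfrak{d}$; (2) for each $I\in D$ and each $n\in\omega$ there is $l_n\in\omega$ with $l_n>0$, $l_n\ge n$, and $|I_n|=2^{l_n}$; (3) for every interval partition $J$ there is $I\in D$ such that for all but finitely many $n\in\omega$ there exists $k>n$ with $J_k\subset I_n$.
   Context: An interval partition is a sequence $I=\langle i_n:n\in\omega\rangle\in\omega^\omega$ with $i_0=0$ and $i_n<i_{n+1}$ for all $n$; its $n$th interval is $I_n=[i_n,i_{n+1})$. $\mathfrak{d}$ is the least cardinality of a dominating family in $\omega^\omega$ (a family $F$ such that every $g\in\omega^\omega$ is eventually dominated by some member of $F$). -}

module Defs where

open import Data.Nat using (ℕ; zero; suc; _≤_; _<_; _∸_; _^_)
open import Data.Product using (Σ; ∃; _×_)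
open import Relation.Binary.PropositionalEquality using (_≡_)

record IntervalPartition : Set where
  field
    pt     : ℕ → ℕ
    pt-0   : pt 0 ≡ 0
    pt-inc : ∀ n → pt n < pt (suc n)
open IntervalPartition public

_∈Int_at_ : ℕ → IntervalPartition → ℕ → Set
m ∈Int I at n = pt I n ≤ m × m < pt I (suc n)

IntSub : IntervalPartition → ℕ → IntervalPartition → ℕ → Set
IntSub J k I n = ∀ m → m ∈Int J at k → m ∈Int I at n

intLen : IntervalPartition → ℕ → ℕ
intLen I n = pt I (suc n) ∸ pt I n

_≤*_ : (ℕ → ℕ) → (ℕ → ℕ) → Set
g ≤* f = ∃ λ N → ∀ n → N ≤ n → g n ≤ f n

Dominating : {A : Set} → (A → ℕ → ℕ) → Set
Dominating {A} F = ∀ (g : ℕ → ℕ) → ∃ λ (a : A) → g ≤* F a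

-- Given a dominating family F, build for each a the partition whose n-th interval has length
-- 2^(l n) with l n = 1 + n + F a (i_n + n), where i_n is its n-th endpoint. For any J, some
-- F a eventually dominates x ↦ j_(x+2); then J_k with k = i_n + n + 1 starts at j_k ≥ k > i_n
-- and ends at j_(k+1) ≤ F a (i_n + n) < 2^(l n) ≤ i_(n+1), so it lies inside I_n.
module Submission where

open import Defs
open import Data.Nat using (ℕ; _≤_; _<_; _^_; zero; suc; _+_; z≤n; s≤s)
open import Data.Nat.Properties
open import Data.Product using (Σ; ∃; _×_; _,_)
open import Relation.Binary.PropositionalEquality using (_≡_; refl; cong; sym)

n<2^n : ∀ n → n < 2 ^ n
n<2^n zero    = s≤s z≤n
n<2^n (suc n) = begin-strict
  suc n           ≡⟨ +-comm 1 n ⟩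
  n + 1           <⟨ +-monoˡ-< 1 (n<2^n n) ⟩
  2 ^ n + 1       ≤⟨ +-monoʳ-≤ (2 ^ n) (m^n>0 2 n) ⟩
  2 ^ n + 2 ^ n   ≡⟨ cong (2 ^ n +_) (sym (+-identityʳ (2 ^ n))) ⟩
  2 ^ suc n       ∎
  where
  open ≤-Reasoning

n≤pt : (I : IntervalPartition) → ∀ n → n ≤ pt I n
n≤pt I zero    = z≤n
n≤pt I (suc n) = ≤-<-trans (n≤pt I n) (pt-inc I n)

interval-⊆ : ∀ (J : IntervalPartition) k (I : IntervalPartition) n →
  pt I n ≤ pt J k → pt J (suc k) ≤ pt I (suc n) → IntSub J k I n
interval-⊆ J k I n start end m (j≤m , m<j′) = ≤-trans start j≤m , <-≤-trans m<j′ end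

module DyadicPartition (f : ℕ → ℕ) where

  mutual
    endpoint : ℕ → ℕ
    endpoint zero    = 0
    endpoint (suc n) = endpoint n + 2 ^ exponent n

    exponent : ℕ → ℕ
    exponent n = suc (n + f (endpoint n + n))

  partition : IntervalPartition
  partition = record
    { pt     = endpoint
    ; pt-0   = refl
    ; pt-inc = λ n → m<m+n (endpoint n) (m^n>0 2 (exponent n))
    }

  intLen≡2^exponent : ∀ n → intLen partition n ≡ 2 ^ exponent n
  intLen≡2^exponent n = m+n∸m≡n (endpoint n) (2 ^ exponent n)

  f≤endpoint : ∀ n → f (endpoint n + n) ≤ endpoint (suc n)
  f≤endpoint n = begin
    f (endpoint n + n)              ≤⟨ m≤n+m _ n ⟩
    n + f (endpoint n + n)          <⟨ n<1+n _ ⟩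
    exponent n                      <⟨ n<2^n (exponent n) ⟩
    2 ^ exponent n                  ≤⟨ m≤n+m _ (endpoint n) ⟩
    endpoint n + 2 ^ exponent n     ∎
    where open ≤-Reasoning

  swallows : ∀ (J : IntervalPartition) n → pt J (2 + (endpoint n + n)) ≤ f (endpoint n + n) →
             IntSub J (suc (endpoint n + n)) partition n
  swallows J n j≤f = interval-⊆ J _ partition n
    (≤-trans (m≤m+n (endpoint n) n) (<⇒≤ (n≤pt J (suc (endpoint n + n)))))
    (≤-trans j≤f (f≤endpoint n))

lemma2p4 : (A : Set) (F : A → ℕ → ℕ) → Dominating F →
  Σ (A → IntervalPartition) λ D →
    (∀ a n → ∃ λ l → 0 < l × n ≤ l × intLen (D a) n ≡ 2 ^ l)
    × (∀ (J : IntervalPartition) → ∃ λ a → ∃ λ N → ∀ n → N ≤ n →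
         ∃ λ k → n < k × IntSub J k (D a) n)
lemma2p4 A F dominating = D , lengths , refines
  where
  open DyadicPartition

  D : A → IntervalPartition
  D a = partition (F a)

  lengths : ∀ a n → ∃ λ l → 0 < l × n ≤ l × intLen (D a) n ≡ 2 ^ l
  lengths a n = exponent (F a) n , s≤s z≤n , m≤n⇒m≤1+n (m≤m+n n _) , intLen≡2^exponent (F a) n

  refines : ∀ (J : IntervalPartition) → ∃ λ a → ∃ λ N → ∀ n → N ≤ n →
              ∃ λ k → n < k × IntSub J k (D a) n
  refines J with dominating (λ x → pt J (2 + x))
  ... | a , N , dominated = a , N , λ n N≤n →
    let x = endpoint (F a) n + n in
    suc x , s≤s (m≤n+m n _) , swallows (F a) J n (dominated x (≤-trans N≤n (m≤n+m n _)))
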